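{- Let $A$ be a pseudo-BCI algebra and $d:A\to A$ a map. Then $d$ is a regular type II implicative derivation on $A$ if and only if $d(1)=1$ and $d(x\to y)=x\to d(y)$ and $d(x\rightsquigarrow y)=x\rightsquigarrow d(y)$ for all $x,y\in A$.
   Context: A pseudo-BCI algebra is a structure $(A,\to,\rightsquigarrow,1)$ of type $(2,2,0)$ such that for all $x,y,z\in A$: $(x\to y)\rightsquigarrow[(y\to z)\rightsquigarrow(x\to z)]=1$; $(x\rightsquigarrow y)\to[(y\rightsquigarrow z)\to(x\rightsquigarrow z)]=1$; $1\to x=x$; $1\rightsquigarrow x=x$; and $x\to y=1$, $y\to x=1$ imply $x=y$. Put $x\Cup_1 y=(x\to y)\rightsquigarrow y$ and $x\Cup_2 y=(x\rightsquigarrow y)\to y$. A map $d:A\to A$ is a type II implicative derivation if $d(x\to y)=(d(x)\to y)\Cup_2(x\to d(y))$ and $d(x\rightsquigarrow y)=(d(x)\rightsquigarrow y)\Cup_1(x\rightsquigarrow d(y))$ for all $x,y\in A$; it is regular if $d(1)=1$. -}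

module Defs where

open import Level using (Level; suc)
open import Relation.Binary.PropositionalEquality using (_≡_)
open import Data.Product using (_×_)

record PseudoBCI (a : Level) : Set (suc a) where
  infixr 5 _⇒_ _⇝_
  field
    Carrier : Set a
    _⇒_     : Carrier → Carrier → Carrier
    _⇝_     : Carrier → Carrier → Carrier
    one     : Carrier
    ax1     : ∀ x y z → ((x ⇒ y) ⇝ ((y ⇒ z) ⇝ (x ⇒ z))) ≡ one
    ax2     : ∀ x y z → ((x ⇝ y) ⇒ ((y ⇝ z) ⇒ (x ⇝ z))) ≡ one
    ax3     : ∀ x → (one ⇒ x) ≡ x
    ax4     : ∀ x → (one ⇝ x) ≡ x
    ax5     : ∀ x y → (x ⇒ y) ≡ one → (y ⇒ x) ≡ one → x ≡ y

  _⋓₁_ : Carrier → Carrier → Carrier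
  x ⋓₁ y = (x ⇒ y) ⇝ y

  _⋓₂_ : Carrier → Carrier → Carrier
  x ⋓₂ y = (x ⇝ y) ⇒ y

module _ {a : Level} (A : PseudoBCI a) where
  open PseudoBCI A

  IsTypeIIImplicativeDerivation : (Carrier → Carrier) → Set a
  IsTypeIIImplicativeDerivation d =
    (∀ x y → d (x ⇒ y) ≡ ((d x ⇒ y) ⋓₂ (x ⇒ d y)))
    × (∀ x y → d (x ⇝ y) ≡ ((d x ⇝ y) ⋓₁ (x ⇝ d y)))

  IsRegular : (Carrier → Carrier) → Set a
  IsRegular d = d one ≡ one

  IsRegularTypeIIImplicativeDerivation : (Carrier → Carrier) → Set a
  IsRegularTypeIIImplicativeDerivation d =
    IsTypeIIImplicativeDerivation d × IsRegular d

-- Order A by x ≤ y iff x → y = 1. Both sides of the equivalence make d extensive,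
-- x ≤ d x: from the derivation law, d x = d (1 → x) = x ⋓₂ d x ≥ x; from the
-- simplified law, x → d x = d (x → x) = d 1 = 1. For extensive d the arrows'
-- monotonicity gives d x → y ≤ x → d y, and u ⋓₂ v = v whenever u ≤ v
-- (dually for ⇝ and ⋓₁), so the type II equations collapse to the simplified ones.
module Submission where

open import Defs
open import Level using (Level)
open import Relation.Binary.PropositionalEquality
  using (_≡_; sym; trans; cong; cong₂; module ≡-Reasoning)
open import Data.Product using (_×_; _,_; proj₂)
open import Function.Bundles using (_⇔_; mk⇔)

module Properties {a : Level} (A : PseudoBCI a) where
  open PseudoBCI A

  infix 4 _≤_
  _≤_ : Carrier → Carrier → Set a
  x ≤ y = x ⇒ y ≡ one

  ⇒-identityˡ-≡one : ∀ {x y} → x ≡ one → x ⇒ y ≡ y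
  ⇒-identityˡ-≡one {y = y} x≡one = trans (cong (_⇒ y) x≡one) (ax3 y)

  ⇝-identityˡ-≡one : ∀ {x y} → x ≡ one → x ⇝ y ≡ y
  ⇝-identityˡ-≡one {y = y} x≡one = trans (cong (_⇝ y) x≡one) (ax4 y)

  ⇒-detach : ∀ {x y} → x ≡ one → x ⇒ y ≡ one → y ≡ one
  ⇒-detach x≡one x⇒y≡one = trans (sym (⇒-identityˡ-≡one x≡one)) x⇒y≡one

  ⇝-detach : ∀ {x y} → x ≡ one → x ⇝ y ≡ one → y ≡ one
  ⇝-detach x≡one x⇝y≡one = trans (sym (⇝-identityˡ-≡one x≡one)) x⇝y≡one

  x⇝x⋓₁y≡one : ∀ x y → x ⇝ (x ⋓₁ y) ≡ one
  x⇝x⋓₁y≡one x y =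
    trans (cong₂ (λ u v → u ⇝ ((x ⇒ y) ⇝ v)) (sym (ax3 x)) (sym (ax3 y))) (ax1 one x y)

  x≤x⋓₂y : ∀ x y → x ≤ x ⋓₂ y
  x≤x⋓₂y x y =
    trans (cong₂ (λ u v → u ⇒ ((x ⇝ y) ⇒ v)) (sym (ax4 x)) (sym (ax4 y))) (ax2 one x y)

  ≤⇒⇝≡one : ∀ {x y} → x ≤ y → x ⇝ y ≡ one
  ≤⇒⇝≡one {x} {y} x≤y = trans (cong (x ⇝_) (sym (⇝-identityˡ-≡one x≤y))) (x⇝x⋓₁y≡one x y)

  ⇝≡one⇒≤ : ∀ {x y} → x ⇝ y ≡ one → x ≤ y
  ⇝≡one⇒≤ {x} {y} x⇝y≡one = trans (cong (x ⇒_) (sym (⇒-identityˡ-≡one x⇝y≡one))) (x≤x⋓₂y x y)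

  ≤-refl : ∀ x → x ≤ x
  ≤-refl x = begin
    x ⇒ x                                 ≡⟨ sym (ax3 _) ⟩
    one ⇒ (x ⇒ x)                         ≡⟨ cong₂ (λ u v → u ⇒ (v ⇒ v)) (sym (ax4 one)) (sym (ax4 x)) ⟩
    (one ⇝ one) ⇒ ((one ⇝ x) ⇒ (one ⇝ x)) ≡⟨ ax2 one one x ⟩
    one                                   ∎
    where open ≡-Reasoning

  ≤-trans : ∀ {x y z} → x ≤ y → y ≤ z → x ≤ z
  ≤-trans {x} {y} {z} x≤y y≤z = ⇝-detach y≤z (⇝-detach x≤y (ax1 x y z))

  ⇒-antimonoˡ-≤ : ∀ {x y} z → x ≤ y → y ⇒ z ≤ x ⇒ z
  ⇒-antimonoˡ-≤ {x} {y} z x≤y = ⇝≡one⇒≤ (⇝-detach x≤y (ax1 x y z))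

  ⇒-monoʳ-≤ : ∀ x {y z} → y ≤ z → x ⇒ y ≤ x ⇒ z
  ⇒-monoʳ-≤ x {y} {z} y≤z =
    ⇝≡one⇒≤ (trans (cong ((x ⇒ y) ⇝_) (sym (⇝-identityˡ-≡one y≤z))) (ax1 x y z))

  ⇝-antimonoˡ-≤ : ∀ {x y} z → x ≤ y → y ⇝ z ≤ x ⇝ z
  ⇝-antimonoˡ-≤ {x} {y} z x≤y = ⇒-detach (≤⇒⇝≡one x≤y) (ax2 x y z)

  ⇝-monoʳ-≤ : ∀ x {y z} → y ≤ z → x ⇝ y ≤ x ⇝ z
  ⇝-monoʳ-≤ x {y} {z} y≤z =
    trans (cong ((x ⇝ y) ⇒_) (sym (⇒-identityˡ-≡one (≤⇒⇝≡one y≤z)))) (ax2 x y z)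

  ⇒-mono-≤ : ∀ {x y u v} → x ≤ u → y ≤ v → u ⇒ y ≤ x ⇒ v
  ⇒-mono-≤ x≤u y≤v = ≤-trans (⇒-antimonoˡ-≤ _ x≤u) (⇒-monoʳ-≤ _ y≤v)

  ⇝-mono-≤ : ∀ {x y u v} → x ≤ u → y ≤ v → u ⇝ y ≤ x ⇝ v
  ⇝-mono-≤ x≤u y≤v = ≤-trans (⇝-antimonoˡ-≤ _ x≤u) (⇝-monoʳ-≤ _ y≤v)

  x≤y⇒x⋓₁y≡y : ∀ {x y} → x ≤ y → x ⋓₁ y ≡ y
  x≤y⇒x⋓₁y≡y = ⇝-identityˡ-≡one

  x≤y⇒x⋓₂y≡y : ∀ {x y} → x ≤ y → x ⋓₂ y ≡ y
  x≤y⇒x⋓₂y≡y x≤y = ⇒-identityˡ-≡one (≤⇒⇝≡one x≤y)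

module Derivation {a : Level} (A : PseudoBCI a) (d : PseudoBCI.Carrier A → PseudoBCI.Carrier A) where
  open PseudoBCI A
  open Properties A

  CommutesWithTranslations : Set a
  CommutesWithTranslations = (∀ x y → d (x ⇒ y) ≡ x ⇒ d y) × (∀ x y → d (x ⇝ y) ≡ x ⇝ d y)

  Extensive : Set a
  Extensive = ∀ x → x ≤ d x

  typeII-regular⇒extensive :
    IsTypeIIImplicativeDerivation A d → IsRegular A d → Extensive
  typeII-regular⇒extensive (d⇒ , _) d1≡one x = trans (cong (x ⇒_) d≡x⋓₂d) (x≤x⋓₂y x (d x))
    where
    d≡x⋓₂d : d x ≡ x ⋓₂ d x
    d≡x⋓₂d = begin
      d x                           ≡⟨ cong d (sym (ax3 x)) ⟩
      d (one ⇒ x)                   ≡⟨ d⇒ one x ⟩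
      (d one ⇒ x) ⋓₂ (one ⇒ d x)    ≡⟨ cong₂ _⋓₂_ (⇒-identityˡ-≡one d1≡one) (ax3 (d x)) ⟩
      x ⋓₂ d x                      ∎
      where open ≡-Reasoning

  regular-commutes⇒extensive : IsRegular A d → CommutesWithTranslations → Extensive
  regular-commutes⇒extensive d1≡one (d⇒ , _) x =
    trans (sym (d⇒ x x)) (trans (cong d (≤-refl x)) d1≡one)

  module _ (ext : Extensive) where
    ⋓₂-collapse : ∀ x y → (d x ⇒ y) ⋓₂ (x ⇒ d y) ≡ x ⇒ d y
    ⋓₂-collapse x y = x≤y⇒x⋓₂y≡y (⇒-mono-≤ (ext x) (ext y))

    ⋓₁-collapse : ∀ x y → (d x ⇝ y) ⋓₁ (x ⇝ d y) ≡ x ⇝ d y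
    ⋓₁-collapse x y = x≤y⇒x⋓₁y≡y (⇝-mono-≤ (ext x) (ext y))

  regularTypeII⇒commutes : IsRegularTypeIIImplicativeDerivation A d → CommutesWithTranslations
  regularTypeII⇒commutes (derivation@(d⇒ , d⇝) , d1≡one) =
      (λ x y → trans (d⇒ x y) (⋓₂-collapse ext x y))
    , (λ x y → trans (d⇝ x y) (⋓₁-collapse ext x y))
    where
    ext : Extensive
    ext = typeII-regular⇒extensive derivation d1≡one

  regular-commutes⇒typeII : IsRegular A d → CommutesWithTranslations → IsTypeIIImplicativeDerivation A d
  regular-commutes⇒typeII d1≡one commutes@(d⇒ , d⇝) =
      (λ x y → trans (d⇒ x y) (sym (⋓₂-collapse ext x y)))
    , (λ x y → trans (d⇝ x y) (sym (⋓₁-collapse ext x y)))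
    where
    ext : Extensive
    ext = regular-commutes⇒extensive d1≡one commutes

theorem3p23 : {a : Level} (A : PseudoBCI a) (d : PseudoBCI.Carrier A → PseudoBCI.Carrier A) →
    IsRegularTypeIIImplicativeDerivation A d ⇔
    (d (PseudoBCI.one A) ≡ PseudoBCI.one A
    × (∀ x y → d (PseudoBCI._⇒_ A x y) ≡ PseudoBCI._⇒_ A x (d y))
    × (∀ x y → d (PseudoBCI._⇝_ A x y) ≡ PseudoBCI._⇝_ A x (d y)))
theorem3p23 A d = mk⇔
  (λ D → proj₂ D , regularTypeII⇒commutes D)
  (λ (d1≡one , commutes) → regular-commutes⇒typeII d1≡one commutes , d1≡one)
  where open Derivation A d
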